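{- For all integers $n$, $r$ and $k$ with $n\ge r-1\ge 0$, $$\sum_{j=r-1}^n\left\{{n+1\atop j+1}\right\}_r c_j^{(k)}=\sum_{\ell=1}^{r}(-1)^{r-\ell}\left[{r\atop \ell}\right]\sum_{i=0}^{n-r+\ell}\binom{n-r+\ell}{i}\frac{1}{(i+1)^k}.$$
   Context: For an integer $k$, the poly-Cauchy numbers (of the first kind) $c_n^{(k)}$ are defined by $\mathrm{Lif}_k(\log(1+x))=\sum_{n\ge0}c_n^{(k)}x^n/n!$, where $\mathrm{Lif}_k(z)=\sum_{m\ge0}\frac{z^m}{m!(m+1)^k}$. $\left[{n\atop m}\right]$ denotes the unsigned Stirling number of the first kind, defined by $x(x+1)\cdots(x+n-1)=\sum_{m}\left[{n\atop m}\right]x^m$. For $r\ge 0$, the $r$-Stirling number of the second kind $\left\{{n\atop m}\right\}_r$ is the number of ways to partition $\{1,\dots,n\}$ into $m$ nonempty disjoint blocks such that $1,\dots,r$ lie in distinct blocks; equivalently $\left\{{n\atop m}\right\}_r=0$ for $n<r$, $\left\{{r\atop m}\right\}_r=\delta_{m,r}$, and $\left\{{n\atop m}\right\}_r=m\left\{{n-1\atop m}\right\}_r+\left\{{n-1\atop m-1}\right\}_r$ for $n>r$. -}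

module Defs where

open import Data.Nat as ℕ using (ℕ; zero; suc; _∸_; _!)
open import Data.Nat.Properties using (_!≢0)
open import Data.Nat.Combinatorics using (_C_)
open import Data.Bool using (Bool; true; false; if_then_else_)
open import Data.Integer as ℤ using (ℤ; +_; -[1+_])
open import Data.Rational using (ℚ; 0ℚ; 1ℚ; _+_; _*_; -_; _/_)

ι : ℕ → ℚ
ι n = + n / 1

_^ℚ_ : ℚ → ℕ → ℚ
q ^ℚ zero  = 1ℚ
q ^ℚ suc n = q * (q ^ℚ n)

sgn : ℕ → ℚ
sgn n = (- 1ℚ) ^ℚ n

-- 1 / (m+1)^k for an integer k
invPow : ℕ → ℤ → ℚ
invPow m (+ n)     = ((+ 1) / suc m) ^ℚ n
invPow m -[1+ n ]  = ι (suc m) ^ℚ suc n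

Σ0 : ℕ → (ℕ → ℚ) → ℚ
Σ0 zero    f = f 0
Σ0 (suc n) f = Σ0 n f + f (suc n)

Σ[_⋯_] : ℕ → ℕ → (ℕ → ℚ) → ℚ
Σ[ a ⋯ b ] f with b ℕ.<ᵇ a
... | true  = 0ℚ
... | false = Σ0 (b ∸ a) (λ i → f (a ℕ.+ i))

Series : Set
Series = ℕ → ℚ

_⊛_ : Series → Series → Series
(f ⊛ g) n = Σ0 n (λ i → f i * g (n ∸ i))

δ0 : Series
δ0 zero    = 1ℚ
δ0 (suc _) = 0ℚ

_^ˢ_ : Series → ℕ → Series
g ^ˢ zero  = δ0
g ^ˢ suc m = g ⊛ (g ^ˢ m)

-- composition f(g(x)) for g with zero constant term:
-- [x^n] f(g) = Σ_{m=0}^{n} f_m [x^n] g^m  (terms m > n vanish since g(0)=0)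
_∘ˢ_ : Series → Series → Series
(f ∘ˢ g) n = Σ0 n (λ m → f m * (g ^ˢ m) n)

log1p : Series
log1p zero    = 0ℚ
log1p (suc m) = sgn m * ((+ 1) / suc m)

Lif : ℤ → Series
Lif k m = _/_ (+ 1) (m !) {{m !≢0}} * invPow m k

-- poly-Cauchy numbers:  Lif_k(log(1+x)) = Σ c_n^{(k)} x^n / n!
polyCauchy : ℤ → ℕ → ℚ
polyCauchy k n = ι (n !) * (Lif k ∘ˢ log1p) n

-- Unsigned Stirling numbers of the first kind:
-- coefficient of x^m in x(x+1)⋯(x+n-1); risingCoeff (suc n) is the
-- coefficient sequence of risingCoeff n multiplied by (x + n).
stirling1 : ℕ → ℕ → ℕ
stirling1 zero    zero    = 1
stirling1 zero    (suc m) = 0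
stirling1 (suc n) zero    = n ℕ.* stirling1 n zero
stirling1 (suc n) (suc m) = n ℕ.* stirling1 n (suc m) ℕ.+ stirling1 n m

-- r-Stirling numbers of the second kind, via
--   {n m}_r = 0 (n < r),  {r m}_r = δ_{m,r},
--   {n m}_r = m {n-1 m}_r + {n-1 m-1}_r  (n > r)
rStirling2 : ℕ → ℕ → ℕ → ℕ
rStirling2 r zero m with r ℕ.≡ᵇ 0
... | false = 0
... | true  = if m ℕ.≡ᵇ 0 then 1 else 0
rStirling2 r (suc n) m with suc n ℕ.<ᵇ r | suc n ℕ.≡ᵇ r
... | true  | _     = 0
... | false | true  = if m ℕ.≡ᵇ r then 1 else 0
... | false | false = m ℕ.* rStirling2 r n m ℕ.+ prev m
  where
  prev : ℕ → ℕ
  prev zero    = 0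
  prev (suc m′) = rStirling2 r n m′

-- Expanding Lif_k(log(1+x)) with j! [x^j] log(1+x)^m = m! s(j,m), where s(j,m) are the signed
-- Stirling numbers of the first kind, gives c_j^{(k)} = Σ_m s(j,m) / (m+1)^k.  Exchanging sums, the
-- left side becomes Σ_m A_n(m) / (m+1)^k with A_n(m) = Σ_j S_r(n+1, j+1) s(j,m).  Both A_n and
-- B_n(m) = Σ_ℓ s(r,ℓ) C(n-r+ℓ, m) satisfy the Pascal recurrence X_{n+1}(m) = X_n(m) + X_n(m-1)
-- for n ≥ r-1 and equal s(r-1,m) at n = r-1, so A_n = B_n.  Regrouping Σ_m B_n(m) / (m+1)^k by ℓ
-- and using s(r,ℓ) = (-1)^{r-ℓ} [r ℓ] gives the right side.

module Submission where

open import Data.Bool using (true; false; if_then_else_; T)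
open import Data.Empty using (⊥-elim)
open import Data.Integer as ℤ using (ℤ)
import Data.Integer.Properties as ℤP
open import Data.Nat as ℕ
  using (ℕ; zero; suc; _≤_; _<_; _∸_; _≤′_; ≤′-refl; ≤′-step; z≤n; s≤s; _!)
import Data.Nat.Properties as ℕP
open import Data.Nat.Properties using (_!≢0)
open import Data.Nat.Combinatorics using (_C_; nCk+nC[k+1]≡[n+1]C[k+1]; k>n⇒nCk≡0)
open import Data.Rational using (ℚ; 0ℚ; 1ℚ; _+_; _*_; -_; _-_; _/_; toℚᵘ)
import Data.Rational.Properties as ℚP
import Data.Rational.Unnormalised as ℚᵘ
import Data.Rational.Unnormalised.Properties as ℚᵘP
open import Data.Rational.Solver using (module +-*-Solver)
open +-*-Solver using (solve; _:+_; _:*_; _:-_; :-_; _:=_; con)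
open import Relation.Nullary using (¬_; yes; no)
open import Relation.Binary.PropositionalEquality
open ≡-Reasoning

open import Defs

toℚᵘ-ι : ∀ n → toℚᵘ (ι n) ℚᵘ.≃ ℚᵘ.mkℚᵘ (ℤ.+ n) 0
toℚᵘ-ι n = ℚP.toℚᵘ-fromℚᵘ (ℚᵘ.mkℚᵘ (ℤ.+ n) 0)

ι-+ : ∀ m n → ι (m ℕ.+ n) ≡ ι m + ι n
ι-+ m n = ℚP.toℚᵘ-injective (ℚᵘP.≃-trans (toℚᵘ-ι (m ℕ.+ n)) (ℚᵘP.≃-trans cross
  (ℚᵘP.≃-sym (ℚᵘP.≃-trans (ℚP.toℚᵘ-homo-+ (ι m) (ι n)) (ℚᵘP.+-cong (toℚᵘ-ι m) (toℚᵘ-ι n))))))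
  where
  cross : ℚᵘ.mkℚᵘ (ℤ.+ (m ℕ.+ n)) 0 ℚᵘ.≃ ℚᵘ.mkℚᵘ (ℤ.+ m) 0 ℚᵘ.+ ℚᵘ.mkℚᵘ (ℤ.+ n) 0
  cross = ℚᵘ.*≡* (trans (ℤP.*-identityʳ _) (trans (ℤP.pos-+ m n) (sym (trans (ℤP.*-identityʳ _)
    (cong₂ ℤ._+_ (ℤP.*-identityʳ (ℤ.+ m)) (ℤP.*-identityʳ (ℤ.+ n)))))))

ι-* : ∀ m n → ι (m ℕ.* n) ≡ ι m * ι n
ι-* m n = ℚP.toℚᵘ-injective (ℚᵘP.≃-trans (toℚᵘ-ι (m ℕ.* n)) (ℚᵘP.≃-trans cross
  (ℚᵘP.≃-sym (ℚᵘP.≃-trans (ℚP.toℚᵘ-homo-* (ι m) (ι n)) (ℚᵘP.*-cong (toℚᵘ-ι m) (toℚᵘ-ι n))))))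
  where
  cross : ℚᵘ.mkℚᵘ (ℤ.+ (m ℕ.* n)) 0 ℚᵘ.≃ ℚᵘ.mkℚᵘ (ℤ.+ m) 0 ℚᵘ.* ℚᵘ.mkℚᵘ (ℤ.+ n) 0
  cross = ℚᵘ.*≡* (trans (ℤP.*-identityʳ _) (trans (ℤP.pos-* m n) (sym (ℤP.*-identityʳ _))))

ι-suc : ∀ n → ι (suc n) ≡ 1ℚ + ι n
ι-suc = ι-+ 1

1/n*ι-n : ∀ n .{{_ : ℕ.NonZero n}} → (ℤ.+ 1 / n) * ι n ≡ 1ℚ
1/n*ι-n (suc n) = ℚP.toℚᵘ-injective (ℚᵘP.≃-trans (ℚP.toℚᵘ-homo-* (ℤ.+ 1 / suc n) (ι (suc n)))
  (ℚᵘP.≃-trans (ℚᵘP.*-cong (ℚP.toℚᵘ-fromℚᵘ (ℚᵘ.mkℚᵘ (ℤ.+ 1) n)) (toℚᵘ-ι (suc n)))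
  (ℚᵘP.≃-trans cross (ℚᵘP.≃-sym (toℚᵘ-ι 1)))))
  where
  cross : ℚᵘ.mkℚᵘ (ℤ.+ 1) n ℚᵘ.* ℚᵘ.mkℚᵘ (ℤ.+ suc n) 0 ℚᵘ.≃ ℚᵘ.mkℚᵘ (ℤ.+ 1) 0
  cross = ℚᵘ.*≡* (trans (ℤP.*-identityʳ _) (trans (ℤP.*-identityˡ _)
    (trans (cong ℤ.+_ (sym (ℕP.*-identityʳ (suc n)))) (sym (ℤP.*-identityˡ _)))))

x+y≡z⇒x≡z-y : ∀ {x y z : ℚ} → x + y ≡ z → x ≡ z - y
x+y≡z⇒x≡z-y {x} {y} refl = solve 2 (λ x y → x := (x :+ y) :- y) refl x y

-- Finite sums

Σ0-cong : ∀ n {f g : ℕ → ℚ} → (∀ i → f i ≡ g i) → Σ0 n f ≡ Σ0 n g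
Σ0-cong zero    f≡g = f≡g 0
Σ0-cong (suc n) f≡g = cong₂ _+_ (Σ0-cong n f≡g) (f≡g (suc n))

Σ0-cong-≤ : ∀ n {f g : ℕ → ℚ} → (∀ i → i ≤ n → f i ≡ g i) → Σ0 n f ≡ Σ0 n g
Σ0-cong-≤ zero    f≡g = f≡g 0 z≤n
Σ0-cong-≤ (suc n) f≡g =
  cong₂ _+_ (Σ0-cong-≤ n (λ i i≤n → f≡g i (ℕP.m≤n⇒m≤1+n i≤n))) (f≡g (suc n) ℕP.≤-refl)

Σ0-zero : ∀ n {f : ℕ → ℚ} → (∀ i → i ≤ n → f i ≡ 0ℚ) → Σ0 n f ≡ 0ℚ
Σ0-zero n f≡0 = trans (Σ0-cong-≤ n f≡0) (Σ0-0 n)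
  where
  Σ0-0 : ∀ n → Σ0 n (λ _ → 0ℚ) ≡ 0ℚ
  Σ0-0 zero    = refl
  Σ0-0 (suc n) = cong (_+ 0ℚ) (Σ0-0 n)

Σ0-distrib-+ : ∀ n (f g : ℕ → ℚ) → Σ0 n (λ i → f i + g i) ≡ Σ0 n f + Σ0 n g
Σ0-distrib-+ zero    f g = refl
Σ0-distrib-+ (suc n) f g = trans (cong (_+ (f (suc n) + g (suc n))) (Σ0-distrib-+ n f g))
  (solve 4 (λ a b c d → (a :+ b) :+ (c :+ d) := (a :+ c) :+ (b :+ d)) refl
    (Σ0 n f) (Σ0 n g) (f (suc n)) (g (suc n)))

*-distribˡ-Σ0 : ∀ n c (f : ℕ → ℚ) → c * Σ0 n f ≡ Σ0 n (λ i → c * f i)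
*-distribˡ-Σ0 zero    c f = refl
*-distribˡ-Σ0 (suc n) c f =
  trans (ℚP.*-distribˡ-+ c (Σ0 n f) (f (suc n))) (cong (_+ c * f (suc n)) (*-distribˡ-Σ0 n c f))

*-distribʳ-Σ0 : ∀ n c (f : ℕ → ℚ) → Σ0 n f * c ≡ Σ0 n (λ i → f i * c)
*-distribʳ-Σ0 n c f = trans (ℚP.*-comm (Σ0 n f) c)
  (trans (*-distribˡ-Σ0 n c f) (Σ0-cong n (λ i → ℚP.*-comm c (f i))))

neg-distrib-Σ0 : ∀ n (f : ℕ → ℚ) → Σ0 n (λ i → - f i) ≡ - Σ0 n f
neg-distrib-Σ0 zero    f = refl
neg-distrib-Σ0 (suc n) f = trans (cong (_+ - f (suc n)) (neg-distrib-Σ0 n f))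
  (sym (ℚP.neg-distrib-+ (Σ0 n f) (f (suc n))))

Σ0-sucˡ : ∀ n (f : ℕ → ℚ) → Σ0 (suc n) f ≡ f 0 + Σ0 n (λ i → f (suc i))
Σ0-sucˡ zero    f = refl
Σ0-sucˡ (suc n) f = trans (cong (_+ f (suc (suc n))) (Σ0-sucˡ n f)) (ℚP.+-assoc (f 0) _ _)

Σ0-reverse : ∀ n (f : ℕ → ℚ) → Σ0 n f ≡ Σ0 n (λ i → f (n ∸ i))
Σ0-reverse zero    f = refl
Σ0-reverse (suc n) f = sym (begin
  Σ0 (suc n) (λ i → f (suc n ∸ i))   ≡⟨ Σ0-sucˡ n (λ i → f (suc n ∸ i)) ⟩
  f (suc n) + Σ0 n (λ i → f (n ∸ i)) ≡⟨ cong (λ s → f (suc n) + s) (sym (Σ0-reverse n f)) ⟩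
  f (suc n) + Σ0 n f                 ≡⟨ ℚP.+-comm (f (suc n)) (Σ0 n f) ⟩
  Σ0 (suc n) f                       ∎)

Σ0-comm : ∀ n m (F : ℕ → ℕ → ℚ) →
  Σ0 n (λ i → Σ0 m (λ j → F i j)) ≡ Σ0 m (λ j → Σ0 n (λ i → F i j))
Σ0-comm zero    m F = refl
Σ0-comm (suc n) m F =
  trans (cong (_+ Σ0 m (F (suc n))) (Σ0-comm n m F)) (sym (Σ0-distrib-+ m _ _))

Σ0-triangle : ∀ n (F : ℕ → ℕ → ℚ) →
  Σ0 n (λ i → Σ0 i (λ a → F i a)) ≡ Σ0 n (λ a → Σ0 (n ∸ a) (λ b → F (a ℕ.+ b) a))
Σ0-triangle zero    F = refl
Σ0-triangle (suc n) F = begin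
    Σ0 n (λ i → Σ0 i (F i)) + (Σ0 n (F (suc n)) + F (suc n) (suc n))
  ≡⟨ cong (_+ (Σ0 n (F (suc n)) + F (suc n) (suc n))) (Σ0-triangle n F) ⟩
    columns n + (Σ0 n (F (suc n)) + F (suc n) (suc n))
  ≡⟨ sym (ℚP.+-assoc (columns n) (Σ0 n (F (suc n))) (F (suc n) (suc n))) ⟩
    (columns n + Σ0 n (F (suc n))) + F (suc n) (suc n)
  ≡⟨ cong₂ _+_ (trans (sym (Σ0-distrib-+ n _ _)) (Σ0-cong-≤ n grow))
               (cong (λ x → F x (suc n)) (sym (ℕP.+-identityʳ (suc n)))) ⟩
    Σ0 n (λ a → Σ0 (suc n ∸ a) (λ b → F (a ℕ.+ b) a)) + F (suc n ℕ.+ 0) (suc n)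
  ≡⟨ cong (λ d → Σ0 n (λ a → Σ0 (suc n ∸ a) (λ b → F (a ℕ.+ b) a))
                   + Σ0 d (λ b → F (suc n ℕ.+ b) (suc n))) (sym (ℕP.n∸n≡0 n)) ⟩
    Σ0 (suc n) (λ a → Σ0 (suc n ∸ a) (λ b → F (a ℕ.+ b) a))
  ∎
  where
  columns : ℕ → ℚ
  columns n = Σ0 n (λ a → Σ0 (n ∸ a) (λ b → F (a ℕ.+ b) a))
  grow : ∀ a → a ≤ n →
    Σ0 (n ∸ a) (λ b → F (a ℕ.+ b) a) + F (suc n) a ≡ Σ0 (suc n ∸ a) (λ b → F (a ℕ.+ b) a)
  grow a a≤n rewrite ℕP.+-∸-assoc 1 a≤n =
    cong (λ x → Σ0 (n ∸ a) (λ b → F (a ℕ.+ b) a) + F x a)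
      (sym (trans (ℕP.+-suc a (n ∸ a)) (cong suc (ℕP.m+[n∸m]≡n a≤n))))

Σ0-dropLast : ∀ n (f : ℕ → ℚ) → f (suc n) ≡ 0ℚ → Σ0 (suc n) f ≡ Σ0 n f
Σ0-dropLast n f f≡0 = trans (cong (λ s → Σ0 n f + s) f≡0) (ℚP.+-identityʳ (Σ0 n f))

Σ0-onlyLast : ∀ n (f : ℕ → ℚ) → (∀ i → i < n → f i ≡ 0ℚ) → Σ0 n f ≡ f n
Σ0-onlyLast zero    f f≡0 = refl
Σ0-onlyLast (suc n) f f≡0 =
  trans (cong (_+ f (suc n)) (Σ0-zero n (λ i i≤n → f≡0 i (s≤s i≤n)))) (ℚP.+-identityˡ (f (suc n)))

Σ0-extend : ∀ {N n} (f : ℕ → ℚ) → N ≤ n → (∀ i → N < i → f i ≡ 0ℚ) → Σ0 N f ≡ Σ0 n f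
Σ0-extend {N} f N≤n f≡0 = go (ℕP.≤⇒≤′ N≤n)
  where
  go : ∀ {n} → N ≤′ n → Σ0 N f ≡ Σ0 n f
  go ≤′-refl          = refl
  go (≤′-step {n} N≤n) = trans (go N≤n) (sym (Σ0-dropLast n f (f≡0 (suc n) (s≤s (ℕP.≤′⇒≤ N≤n)))))

Σ0-dropPrefix : ∀ a t (f : ℕ → ℚ) → (∀ j → j < a → f j ≡ 0ℚ) →
  Σ0 (a ℕ.+ t) f ≡ Σ0 t (λ i → f (a ℕ.+ i))
Σ0-dropPrefix zero    t f f≡0 = refl
Σ0-dropPrefix (suc a) t f f≡0 = begin
  Σ0 (suc a ℕ.+ t) f                        ≡⟨ Σ0-sucˡ (a ℕ.+ t) f ⟩
  f 0 + Σ0 (a ℕ.+ t) (λ j → f (suc j))     ≡⟨ cong₂ _+_ (f≡0 0 (s≤s z≤n))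
                                                (Σ0-dropPrefix a t (λ j → f (suc j)) (λ j j<a → f≡0 (suc j) (s≤s j<a))) ⟩
  0ℚ + Σ0 t (λ i → f (suc a ℕ.+ i))         ≡⟨ ℚP.+-identityˡ _ ⟩
  Σ0 t (λ i → f (suc a ℕ.+ i))              ∎

<ᵇ-false : ∀ m n → n ≤ m → (m ℕ.<ᵇ n) ≡ false
<ᵇ-false m       zero    _         = refl
<ᵇ-false (suc m) (suc n) (s≤s n≤m) = <ᵇ-false m n n≤m

Σ-range≡Σ0 : ∀ a b (f : ℕ → ℚ) → a ≤ b → Σ[ a ⋯ b ] f ≡ Σ0 (b ∸ a) (λ i → f (a ℕ.+ i))
Σ-range≡Σ0 a b f a≤b rewrite <ᵇ-false b a a≤b = refl

Σ-range≡Σ0-from-0 : ∀ {a n} (f : ℕ → ℚ) → a ≤ n → (∀ j → j < a → f j ≡ 0ℚ) →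
  Σ[ a ⋯ n ] f ≡ Σ0 n f
Σ-range≡Σ0-from-0 {a} {n} f a≤n f≡0 = begin
  Σ[ a ⋯ n ] f                      ≡⟨ Σ-range≡Σ0 a n f a≤n ⟩
  Σ0 (n ∸ a) (λ i → f (a ℕ.+ i))   ≡⟨ sym (Σ0-dropPrefix a (n ∸ a) f f≡0) ⟩
  Σ0 (a ℕ.+ (n ∸ a)) f              ≡⟨ cong (λ t → Σ0 t f) (ℕP.m+[n∸m]≡n a≤n) ⟩
  Σ0 n f                            ∎

-- Formal power series

shift : Series → Series
shift f zero    = 0ℚ
shift f (suc m) = f m

shift-cong : ∀ {f g : Series} → (∀ m → f m ≡ g m) → ∀ m → shift f m ≡ shift g m
shift-cong f≡g zero    = refl
shift-cong f≡g (suc m) = f≡g m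

⊛-congˡ : ∀ {f f′ : Series} (g : Series) → (∀ i → f i ≡ f′ i) → ∀ n → (f ⊛ g) n ≡ (f′ ⊛ g) n
⊛-congˡ g f≡f′ n = Σ0-cong n (λ i → cong (_* g (n ∸ i)) (f≡f′ i))

⊛-congʳ : ∀ (f : Series) {g g′ : Series} → (∀ i → g i ≡ g′ i) → ∀ n → (f ⊛ g) n ≡ (f ⊛ g′) n
⊛-congʳ f g≡g′ n = Σ0-cong n (λ i → cong (f i *_) (g≡g′ (n ∸ i)))

⊛-comm : ∀ (f g : Series) n → (f ⊛ g) n ≡ (g ⊛ f) n
⊛-comm f g n = trans (Σ0-reverse n _) (Σ0-cong-≤ n (λ i i≤n →
  trans (cong (λ j → f (n ∸ i) * g j) (ℕP.m∸[m∸n]≡n i≤n)) (ℚP.*-comm (f (n ∸ i)) (g i))))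

⊛-assoc : ∀ (f g h : Series) n → ((f ⊛ g) ⊛ h) n ≡ (f ⊛ (g ⊛ h)) n
⊛-assoc f g h n = begin
    Σ0 n (λ i → Σ0 i (λ a → f a * g (i ∸ a)) * h (n ∸ i))
  ≡⟨ Σ0-cong n (λ i → *-distribʳ-Σ0 i (h (n ∸ i)) _) ⟩
    Σ0 n (λ i → Σ0 i (λ a → f a * g (i ∸ a) * h (n ∸ i)))
  ≡⟨ Σ0-triangle n _ ⟩
    Σ0 n (λ a → Σ0 (n ∸ a) (λ b → f a * g (a ℕ.+ b ∸ a) * h (n ∸ (a ℕ.+ b))))
  ≡⟨ Σ0-cong n (λ a → Σ0-cong (n ∸ a) (λ b → trans
       (cong₂ (λ x y → f a * g x * h y) (ℕP.m+n∸m≡n a b) (sym (ℕP.∸-+-assoc n a b)))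
       (ℚP.*-assoc (f a) (g b) (h (n ∸ a ∸ b))))) ⟩
    Σ0 n (λ a → Σ0 (n ∸ a) (λ b → f a * (g b * h (n ∸ a ∸ b))))
  ≡⟨ Σ0-cong n (λ a → sym (*-distribˡ-Σ0 (n ∸ a) (f a) _)) ⟩
    Σ0 n (λ a → f a * Σ0 (n ∸ a) (λ b → g b * h (n ∸ a ∸ b)))
  ∎

⊛-scaleʳ : ∀ (f g : Series) c n → (f ⊛ (λ i → c * g i)) n ≡ c * (f ⊛ g) n
⊛-scaleʳ f g c n = trans
  (Σ0-cong n (λ i → solve 3 (λ x y z → x :* (y :* z) := y :* (x :* z)) refl (f i) c (g (n ∸ i))))
  (sym (*-distribˡ-Σ0 n c _))

∂ : Series → Series
∂ f n = ι (suc n) * f (suc n)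

∂-⊛ : ∀ (f g : Series) n → ∂ (f ⊛ g) n ≡ (∂ f ⊛ g) n + (f ⊛ ∂ g) n
∂-⊛ f g n = begin
    ι (suc n) * Σ0 (suc n) (λ i → f i * g (suc n ∸ i))
  ≡⟨ *-distribˡ-Σ0 (suc n) (ι (suc n)) _ ⟩
    Σ0 (suc n) (λ i → ι (suc n) * (f i * g (suc n ∸ i)))
  ≡⟨ Σ0-cong-≤ (suc n) split ⟩
    Σ0 (suc n) (λ i → ι i * f i * g (suc n ∸ i) + f i * (ι (suc n ∸ i) * g (suc n ∸ i)))
  ≡⟨ Σ0-distrib-+ (suc n) _ _ ⟩
    Σ0 (suc n) (λ i → ι i * f i * g (suc n ∸ i)) + Σ0 (suc n) (λ i → f i * (ι (suc n ∸ i) * g (suc n ∸ i)))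
  ≡⟨ cong₂ _+_ left right ⟩
    (∂ f ⊛ g) n + (f ⊛ ∂ g) n
  ∎
  where
  split : ∀ i → i ≤ suc n → ι (suc n) * (f i * g (suc n ∸ i))
                          ≡ ι i * f i * g (suc n ∸ i) + f i * (ι (suc n ∸ i) * g (suc n ∸ i))
  split i i≤1+n = trans
    (cong (_* (f i * g (suc n ∸ i))) (trans (cong ι (sym (ℕP.m+[n∸m]≡n i≤1+n))) (ι-+ i (suc n ∸ i))))
    (solve 4 (λ a b x y → (a :+ b) :* (x :* y) := a :* x :* y :+ x :* (b :* y)) refl
      (ι i) (ι (suc n ∸ i)) (f i) (g (suc n ∸ i)))
  left : Σ0 (suc n) (λ i → ι i * f i * g (suc n ∸ i)) ≡ (∂ f ⊛ g) n
  left = trans (Σ0-sucˡ n _) (trans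
    (cong (_+ Σ0 n (λ i → ι (suc i) * f (suc i) * g (n ∸ i)))
      (trans (cong (_* g (suc n)) (ℚP.*-zeroˡ (f 0))) (ℚP.*-zeroˡ (g (suc n)))))
    (ℚP.+-identityˡ _))
  right : Σ0 (suc n) (λ i → f i * (ι (suc n ∸ i) * g (suc n ∸ i))) ≡ (f ⊛ ∂ g) n
  right = trans
    (cong (λ s → Σ0 n (λ i → f i * (ι (suc n ∸ i) * g (suc n ∸ i))) + s)
      (trans (cong (λ d → f (suc n) * (ι d * g d)) (ℕP.n∸n≡0 n))
        (trans (cong (f (suc n) *_) (ℚP.*-zeroˡ (g 0))) (ℚP.*-zeroʳ (f (suc n))))))
    (trans (ℚP.+-identityʳ _)
      (Σ0-cong-≤ n (λ i i≤n → cong (λ d → f i * (ι d * g d)) (ℕP.+-∸-assoc 1 i≤n))))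

∂-^ˢ : ∀ (f : Series) m n → ∂ (f ^ˢ suc m) n ≡ ι (suc m) * (∂ f ⊛ (f ^ˢ m)) n
∂-^ˢ f zero n = begin
    ∂ (f ⊛ δ0) n
  ≡⟨ ∂-⊛ f δ0 n ⟩
    (∂ f ⊛ δ0) n + (f ⊛ ∂ δ0) n
  ≡⟨ cong ((∂ f ⊛ δ0) n +_)
       (Σ0-zero n (λ i _ → trans (cong (f i *_) (ℚP.*-zeroʳ (ι (suc (n ∸ i))))) (ℚP.*-zeroʳ (f i)))) ⟩
    (∂ f ⊛ δ0) n + 0ℚ
  ≡⟨ trans (ℚP.+-identityʳ ((∂ f ⊛ δ0) n)) (sym (ℚP.*-identityˡ ((∂ f ⊛ δ0) n))) ⟩
    ι 1 * (∂ f ⊛ δ0) n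
  ∎
∂-^ˢ f (suc m) n = begin
    ∂ (f ⊛ (f ^ˢ suc m)) n
  ≡⟨ ∂-⊛ f (f ^ˢ suc m) n ⟩
    X + (f ⊛ ∂ (f ^ˢ suc m)) n
  ≡⟨ cong (X +_) (⊛-congʳ f (∂-^ˢ f m) n) ⟩
    X + (f ⊛ (λ i → ι (suc m) * (∂ f ⊛ (f ^ˢ m)) i)) n
  ≡⟨ cong (X +_) (⊛-scaleʳ f (∂ f ⊛ (f ^ˢ m)) (ι (suc m)) n) ⟩
    X + ι (suc m) * (f ⊛ (∂ f ⊛ (f ^ˢ m))) n
  ≡⟨ cong (λ y → X + ι (suc m) * y) f⊛∂f⊛fᵐ ⟩
    X + ι (suc m) * X
  ≡⟨ solve 2 (λ x c → x :+ c :* x := (con 1ℚ :+ c) :* x) refl X (ι (suc m)) ⟩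
    (1ℚ + ι (suc m)) * X
  ≡⟨ cong (_* X) (sym (ι-suc (suc m))) ⟩
    ι (suc (suc m)) * X
  ∎
  where
  X : ℚ
  X = (∂ f ⊛ (f ^ˢ suc m)) n
  f⊛∂f⊛fᵐ : (f ⊛ (∂ f ⊛ (f ^ˢ m))) n ≡ X
  f⊛∂f⊛fᵐ = begin
    (f ⊛ (∂ f ⊛ (f ^ˢ m))) n    ≡⟨ sym (⊛-assoc f (∂ f) (f ^ˢ m) n) ⟩
    ((f ⊛ ∂ f) ⊛ (f ^ˢ m)) n    ≡⟨ ⊛-congˡ (f ^ˢ m) (⊛-comm f (∂ f)) n ⟩
    ((∂ f ⊛ f) ⊛ (f ^ˢ m)) n    ≡⟨ ⊛-assoc (∂ f) f (f ^ˢ m) n ⟩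
    X                         ∎

-- sgn is the series of 1/(1+x), so convolving with it inverts multiplication by 1 + x
sgn-⊛-telescope : ∀ (f : Series) j → (sgn ⊛ f) (suc j) + (sgn ⊛ f) j ≡ f (suc j)
sgn-⊛-telescope f j = begin
    (sgn ⊛ f) (suc j) + (sgn ⊛ f) j
  ≡⟨ cong (_+ (sgn ⊛ f) j) (Σ0-sucˡ j _) ⟩
    (1ℚ * f (suc j) + Σ0 j (λ i → (- 1ℚ * sgn i) * f (j ∸ i))) + (sgn ⊛ f) j
  ≡⟨ cong (λ s → (1ℚ * f (suc j) + s) + (sgn ⊛ f) j)
       (trans (Σ0-cong j (λ i → solve 2 (λ s x → (:- con 1ℚ :* s) :* x := :- (s :* x)) refl
                                   (sgn i) (f (j ∸ i))))
              (neg-distrib-Σ0 j _)) ⟩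
    (1ℚ * f (suc j) + - (sgn ⊛ f) j) + (sgn ⊛ f) j
  ≡⟨ solve 2 (λ a x → (con 1ℚ :* a :+ :- x) :+ x := a) refl (f (suc j)) ((sgn ⊛ f) j) ⟩
    f (suc j)
  ∎

∂-log1p : ∀ n → ∂ log1p n ≡ sgn n
∂-log1p n = begin
  ι (suc n) * (sgn n * (ℤ.+ 1 / suc n))  ≡⟨ solve 3 (λ a s b → a :* (s :* b) := s :* (b :* a)) refl
                                             (ι (suc n)) (sgn n) (ℤ.+ 1 / suc n) ⟩
  sgn n * ((ℤ.+ 1 / suc n) * ι (suc n))  ≡⟨ cong (sgn n *_) (1/n*ι-n (suc n)) ⟩
  sgn n * 1ℚ                           ≡⟨ ℚP.*-identityʳ (sgn n) ⟩
  sgn n                                ∎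

log1p-^ˢ-at-0 : ∀ m → (log1p ^ˢ suc m) 0 ≡ 0ℚ
log1p-^ˢ-at-0 m = ℚP.*-zeroˡ ((log1p ^ˢ m) 0)

-- (1 + x) · ∂ (log(1+x)^(m+1)) = (m + 1) · log(1+x)^m, read off at x^j
log1p-^ˢ-recurrence : ∀ m j →
  ι (suc j) * (log1p ^ˢ suc m) (suc j) + ι j * (log1p ^ˢ suc m) j ≡ ι (suc m) * (log1p ^ˢ m) j
log1p-^ˢ-recurrence m zero = begin
    ∂ (log1p ^ˢ suc m) 0 + ι 0 * (log1p ^ˢ suc m) 0
  ≡⟨ cong₂ _+_ (∂-^ˢ log1p m 0) (trans (cong (ι 0 *_) (log1p-^ˢ-at-0 m)) (ℚP.*-zeroʳ (ι 0))) ⟩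
    ι (suc m) * (∂ log1p ⊛ (log1p ^ˢ m)) 0 + 0ℚ
  ≡⟨ ℚP.+-identityʳ _ ⟩
    ι (suc m) * (∂ log1p 0 * (log1p ^ˢ m) 0)
  ≡⟨ cong (λ y → ι (suc m) * (y * (log1p ^ˢ m) 0)) (∂-log1p 0) ⟩
    ι (suc m) * (1ℚ * (log1p ^ˢ m) 0)
  ≡⟨ cong (ι (suc m) *_) (ℚP.*-identityˡ _) ⟩
    ι (suc m) * (log1p ^ˢ m) 0
  ∎
log1p-^ˢ-recurrence m (suc j) = begin
    ∂ (log1p ^ˢ suc m) (suc j) + ∂ (log1p ^ˢ suc m) j
  ≡⟨ cong₂ _+_ (∂-^ˢ log1p m (suc j)) (∂-^ˢ log1p m j) ⟩
    ι (suc m) * (∂ log1p ⊛ (log1p ^ˢ m)) (suc j) + ι (suc m) * (∂ log1p ⊛ (log1p ^ˢ m)) j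
  ≡⟨ sym (ℚP.*-distribˡ-+ (ι (suc m)) _ _) ⟩
    ι (suc m) * ((∂ log1p ⊛ (log1p ^ˢ m)) (suc j) + (∂ log1p ⊛ (log1p ^ˢ m)) j)
  ≡⟨ cong (ι (suc m) *_) (cong₂ _+_ (⊛-congˡ (log1p ^ˢ m) ∂-log1p (suc j)) (⊛-congˡ (log1p ^ˢ m) ∂-log1p j)) ⟩
    ι (suc m) * ((sgn ⊛ (log1p ^ˢ m)) (suc j) + (sgn ⊛ (log1p ^ˢ m)) j)
  ≡⟨ cong (ι (suc m) *_) (sgn-⊛-telescope (log1p ^ˢ m) j) ⟩
    ι (suc m) * (log1p ^ˢ m) (suc j)
  ∎

-- Stirling numbers

-- fallingCoeff j m is the coefficient of x^m in x(x-1)⋯(x-j+1), i.e. s(j,m)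
fallingCoeff : ℕ → Series
fallingCoeff zero    m = δ0 m
fallingCoeff (suc j) m = shift (fallingCoeff j) m - ι j * fallingCoeff j m

fallingCoeff-suc-0 : ∀ j → fallingCoeff (suc j) 0 ≡ 0ℚ
fallingCoeff-suc-0 zero = refl
fallingCoeff-suc-0 (suc j) rewrite fallingCoeff-suc-0 j | ℚP.*-zeroʳ (ι (suc j)) = refl

stirling1-vanishes-above : ∀ r m → r < m → stirling1 r m ≡ 0
stirling1-vanishes-above zero    (suc m) _ = refl
stirling1-vanishes-above (suc r) (suc m) (s≤s r<m)
  rewrite stirling1-vanishes-above r (suc m) (ℕP.m≤n⇒m≤1+n r<m)
        | stirling1-vanishes-above r m r<m
        = trans (ℕP.+-identityʳ (r ℕ.* 0)) (ℕP.*-zeroʳ r)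

stirling1-suc-0 : ∀ r → stirling1 (suc r) 0 ≡ 0
stirling1-suc-0 zero    = refl
stirling1-suc-0 (suc r) rewrite stirling1-suc-0 r = ℕP.*-zeroʳ (suc r)

fallingCoeff≡signed-stirling1 : ∀ r ℓ → fallingCoeff r ℓ ≡ sgn (r ∸ ℓ) * ι (stirling1 r ℓ)
fallingCoeff≡signed-stirling1 zero    zero    = refl
fallingCoeff≡signed-stirling1 zero    (suc ℓ) = refl
fallingCoeff≡signed-stirling1 (suc r) zero
  rewrite fallingCoeff-suc-0 r | stirling1-suc-0 r = sym (ℚP.*-zeroʳ (sgn (suc r)))
fallingCoeff≡signed-stirling1 (suc r) (suc ℓ) with ℓ ℕP.<? r
... | yes ℓ<r
  rewrite fallingCoeff≡signed-stirling1 r ℓ | fallingCoeff≡signed-stirling1 r (suc ℓ)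
        | ℕP.+-∸-assoc 1 ℓ<r
        | ι-+ (r ℕ.* stirling1 r (suc ℓ)) (stirling1 r ℓ) | ι-* r (stirling1 r (suc ℓ))
  = solve 4 (λ s x y c → (:- con 1ℚ :* s) :* x :- c :* (s :* y) := (:- con 1ℚ :* s) :* (c :* y :+ x))
      refl (sgn (r ∸ suc ℓ)) (ι (stirling1 r ℓ)) (ι (stirling1 r (suc ℓ))) (ι r)
... | no ℓ≮r
  rewrite fallingCoeff≡signed-stirling1 r ℓ | fallingCoeff≡signed-stirling1 r (suc ℓ)
        | stirling1-vanishes-above r (suc ℓ) (s≤s (ℕP.≮⇒≥ ℓ≮r)) | ℕP.*-zeroʳ r
  = solve 4 (λ s x c t → s :* x :- c :* (t :* con 0ℚ) := s :* x)
      refl (sgn (r ∸ ℓ)) (ι (stirling1 r ℓ)) (ι r) (sgn (r ∸ suc ℓ))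

fallingCoeff-vanishes-above : ∀ j m → j < m → fallingCoeff j m ≡ 0ℚ
fallingCoeff-vanishes-above j m j<m rewrite fallingCoeff≡signed-stirling1 j m
  | stirling1-vanishes-above j m j<m = ℚP.*-zeroʳ (sgn (j ∸ m))

log1p-^ˢ-coefficient : ∀ j m → ι (j !) * (log1p ^ˢ m) j ≡ ι (m !) * fallingCoeff j m
log1p-^ˢ-coefficient zero zero = refl
log1p-^ˢ-coefficient zero (suc m) = begin
  ι 1 * (log1p ^ˢ suc m) 0   ≡⟨ cong (ι 1 *_) (log1p-^ˢ-at-0 m) ⟩
  ι 1 * 0ℚ                   ≡⟨ ℚP.*-zeroʳ (ι 1) ⟩
  0ℚ                         ≡⟨ sym (ℚP.*-zeroʳ (ι (suc m !))) ⟩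
  ι (suc m !) * 0ℚ           ∎
log1p-^ˢ-coefficient (suc j) zero = begin
  ι (suc j !) * 0ℚ             ≡⟨ ℚP.*-zeroʳ (ι (suc j !)) ⟩
  0ℚ                           ≡⟨ sym (ℚP.*-zeroʳ (ι 1)) ⟩
  ι 1 * 0ℚ                     ≡⟨ cong (ι 1 *_) (sym (fallingCoeff-suc-0 j)) ⟩
  ι 1 * fallingCoeff (suc j) 0 ∎
log1p-^ˢ-coefficient (suc j) (suc m) = begin
    ι (suc j ℕ.* j !) * p
  ≡⟨ cong (_* p) (ι-* (suc j) (j !)) ⟩
    ι (suc j) * a * p
  ≡⟨ solve 3 (λ a b p → b :* a :* p := a :* (b :* p)) refl a (ι (suc j)) p ⟩
    a * (ι (suc j) * p)
  ≡⟨ cong (a *_) (x+y≡z⇒x≡z-y (log1p-^ˢ-recurrence m j)) ⟩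
    a * (c * q - ι j * r)
  ≡⟨ solve 5 (λ a c q d r → a :* (c :* q :- d :* r) := c :* (a :* q) :- d :* (a :* r)) refl a c q (ι j) r ⟩
    c * (a * q) - ι j * (a * r)
  ≡⟨ cong₂ (λ x y → c * x - ι j * y) (log1p-^ˢ-coefficient j m) (log1p-^ˢ-coefficient j (suc m)) ⟩
    c * (e * fallingCoeff j m) - ι j * (ι (suc m ℕ.* m !) * fallingCoeff j (suc m))
  ≡⟨ cong (λ z → c * (e * fallingCoeff j m) - ι j * (z * fallingCoeff j (suc m))) (ι-* (suc m) (m !)) ⟩
    c * (e * fallingCoeff j m) - ι j * (c * e * fallingCoeff j (suc m))
  ≡⟨ solve 5 (λ c e s d t → c :* (e :* s) :- d :* (c :* e :* t) := c :* e :* (s :- d :* t))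
       refl c e (fallingCoeff j m) (ι j) (fallingCoeff j (suc m)) ⟩
    c * e * fallingCoeff (suc j) (suc m)
  ≡⟨ cong (_* fallingCoeff (suc j) (suc m)) (sym (ι-* (suc m) (m !))) ⟩
    ι (suc m ℕ.* m !) * fallingCoeff (suc j) (suc m)
  ∎
  where
  a c e p q r : ℚ
  a = ι (j !)
  c = ι (suc m)
  e = ι (m !)
  p = (log1p ^ˢ suc m) (suc j)
  q = (log1p ^ˢ m) j
  r = (log1p ^ˢ suc m) j

polyCauchy≡Σ-fallingCoeff : ∀ k j → polyCauchy k j ≡ Σ0 j (λ m → fallingCoeff j m * invPow m k)
polyCauchy≡Σ-fallingCoeff k j = trans (*-distribˡ-Σ0 j (ι (j !)) _) (Σ0-cong j term)
  where
  term : ∀ m → ι (j !) * (Lif k m * (log1p ^ˢ m) j) ≡ fallingCoeff j m * invPow m k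
  term m = begin
      ι (j !) * ((1/m! * g) * (log1p ^ˢ m) j)
    ≡⟨ solve 4 (λ a u g p → a :* ((u :* g) :* p) := u :* g :* (a :* p)) refl (ι (j !)) 1/m! g ((log1p ^ˢ m) j) ⟩
      1/m! * g * (ι (j !) * (log1p ^ˢ m) j)
    ≡⟨ cong (1/m! * g *_) (log1p-^ˢ-coefficient j m) ⟩
      1/m! * g * (ι (m !) * fallingCoeff j m)
    ≡⟨ solve 4 (λ u g v s → u :* g :* (v :* s) := (u :* v) :* (s :* g)) refl 1/m! g (ι (m !)) (fallingCoeff j m) ⟩
      (1/m! * ι (m !)) * (fallingCoeff j m * g)
    ≡⟨ cong (_* (fallingCoeff j m * g)) (1/n*ι-n (m !) {{m !≢0}}) ⟩
      1ℚ * (fallingCoeff j m * g)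
    ≡⟨ ℚP.*-identityˡ _ ⟩
      fallingCoeff j m * g
    ∎
    where
    1/m! g : ℚ
    1/m! = _/_ (ℤ.+ 1) (m !) {{m !≢0}}
    g = invPow m k

≡ᵇ-false : ∀ m n → ¬ m ≡ n → (m ℕ.≡ᵇ n) ≡ false
≡ᵇ-false zero    zero    m≢n = ⊥-elim (m≢n refl)
≡ᵇ-false zero    (suc n) _   = refl
≡ᵇ-false (suc m) zero    _   = refl
≡ᵇ-false (suc m) (suc n) m≢n = ≡ᵇ-false m n (λ m≡n → m≢n (cong suc m≡n))

≡ᵇ-refl : ∀ n → (n ℕ.≡ᵇ n) ≡ true
≡ᵇ-refl zero    = refl
≡ᵇ-refl (suc n) = ≡ᵇ-refl n

rStirling2-vanishes-below : ∀ a N m → m < suc a → rStirling2 (suc a) N m ≡ 0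
rStirling2-vanishes-below a zero m _ = refl
rStirling2-vanishes-below a (suc N) zero _ with N ℕ.<ᵇ a | N ℕ.≡ᵇ a
... | true  | _     = refl
... | false | true  = refl
... | false | false = refl
rStirling2-vanishes-below a (suc N) (suc m) m<r with N ℕ.<ᵇ a | N ℕ.≡ᵇ a
... | true  | _     = refl
... | false | true  rewrite ≡ᵇ-false m a (λ m≡a → ℕP.<-irrefl (cong suc m≡a) m<r) = refl
... | false | false
  rewrite rStirling2-vanishes-below a N (suc m) m<r
        | rStirling2-vanishes-below a N m (ℕP.<-trans (ℕP.n<1+n m) m<r)
  = trans (ℕP.+-identityʳ (m ℕ.* 0)) (ℕP.*-zeroʳ m)

rStirling2-vanishes-above : ∀ a N m → N < m → rStirling2 (suc a) N m ≡ 0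
rStirling2-vanishes-above a zero m _ = refl
rStirling2-vanishes-above a (suc N) (suc m) (s≤s N<m) with N ℕ.<ᵇ a | N ℕ.≡ᵇ a in N≡ᵇa
... | true  | _     = refl
... | false | true  rewrite ≡ᵇ-false m a (λ m≡a → ℕP.<-irrefl
        (trans (ℕP.≡ᵇ⇒≡ N a (subst T (sym N≡ᵇa) _)) (sym m≡a)) N<m) = refl
... | false | false
  rewrite rStirling2-vanishes-above a N (suc m) (ℕP.m≤n⇒m≤1+n N<m)
        | rStirling2-vanishes-above a N m N<m
  = trans (ℕP.+-identityʳ (m ℕ.* 0)) (ℕP.*-zeroʳ m)

rStirling2-diagonal : ∀ a m → rStirling2 (suc a) (suc a) m ≡ (if m ℕ.≡ᵇ suc a then 1 else 0)
rStirling2-diagonal a m rewrite <ᵇ-false a a ℕP.≤-refl | ≡ᵇ-refl a = refl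

rStirling2-suc : ∀ a N j → a ≤ N →
  rStirling2 (suc a) (suc (suc N)) (suc j)
    ≡ suc j ℕ.* rStirling2 (suc a) (suc N) (suc j) ℕ.+ rStirling2 (suc a) (suc N) j
rStirling2-suc a N j a≤N
  rewrite <ᵇ-false (suc N) a (ℕP.m≤n⇒m≤1+n a≤N)
        | ≡ᵇ-false (suc N) a (λ 1+N≡a → ℕP.<-irrefl (sym 1+N≡a) (s≤s a≤N))
  = refl

-- The Pascal recurrence in n

PascalStep : (ℕ → Series) → ℕ → Set
PascalStep φ n = ∀ m → φ (suc n) m ≡ φ n m + shift (φ n) m

PascalStep-unique : ∀ {a} (φ ψ : ℕ → Series) →
  (∀ {n} → a ≤ n → PascalStep φ n) → (∀ {n} → a ≤ n → PascalStep ψ n) →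
  (∀ m → φ a m ≡ ψ a m) → ∀ {n} → a ≤ n → ∀ m → φ n m ≡ ψ n m
PascalStep-unique {a} φ ψ φ-step ψ-step φa≡ψa a≤n = go (ℕP.≤⇒≤′ a≤n)
  where
  go : ∀ {n} → a ≤′ n → ∀ m → φ n m ≡ ψ n m
  go ≤′-refl          = φa≡ψa
  go (≤′-step {n} a≤n) m = begin
    φ (suc n) m                  ≡⟨ φ-step (ℕP.≤′⇒≤ a≤n) m ⟩
    φ n m + shift (φ n) m        ≡⟨ cong₂ _+_ (go a≤n m) (shift-cong (go a≤n) m) ⟩
    ψ n m + shift (ψ n) m        ≡⟨ sym (ψ-step (ℕP.≤′⇒≤ a≤n) m) ⟩
    ψ (suc n) m                  ∎

binomial-PascalStep : ∀ N → PascalStep (λ N m → ι (N C m)) N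
binomial-PascalStep N zero    = sym (ℚP.+-identityʳ (ι (N C 0)))
binomial-PascalStep N (suc m) = begin
  ι (suc N C suc m)             ≡⟨ cong ι (sym (nCk+nC[k+1]≡[n+1]C[k+1] N m)) ⟩
  ι (N C m ℕ.+ N C suc m)       ≡⟨ ι-+ (N C m) (N C suc m) ⟩
  ι (N C m) + ι (N C suc m)     ≡⟨ ℚP.+-comm (ι (N C m)) (ι (N C suc m)) ⟩
  ι (N C suc m) + ι (N C m)     ∎

Σ0-*-shift : ∀ n (c : ℕ → ℚ) (f : ℕ → Series) m →
  Σ0 n (λ i → c i * shift (f i) m) ≡ shift (λ m → Σ0 n (λ i → c i * f i m)) m
Σ0-*-shift n c f zero    = Σ0-zero n (λ i _ → ℚP.*-zeroʳ (c i))
Σ0-*-shift n c f (suc m) = refl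

Σ-fallingCoeff-binomial : ∀ a m → Σ0 a (λ i → fallingCoeff (suc a) (suc i) * ι (i C m)) ≡ fallingCoeff a m
Σ-fallingCoeff-binomial zero zero    = refl
Σ-fallingCoeff-binomial zero (suc m) = refl
Σ-fallingCoeff-binomial (suc a) m = begin
    Σ0 (suc a) (λ i → (s i - ι (suc a) * s (suc i)) * ι (i C m))
  ≡⟨ Σ0-cong (suc a) (λ i → solve 4 (λ x c y z → (x :- c :* y) :* z := x :* z :+ (:- c) :* (y :* z))
                                refl (s i) (ι (suc a)) (s (suc i)) (ι (i C m))) ⟩
    Σ0 (suc a) (λ i → s i * ι (i C m) + (- ι (suc a)) * (s (suc i) * ι (i C m)))
  ≡⟨ Σ0-distrib-+ (suc a) _ _ ⟩
    Σ0 (suc a) (λ i → s i * ι (i C m)) + Σ0 (suc a) (λ i → (- ι (suc a)) * (s (suc i) * ι (i C m)))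
  ≡⟨ cong₂ _+_ (unshifted m) (trans (sym (*-distribˡ-Σ0 (suc a) (- ι (suc a)) _))
                                    (cong ((- ι (suc a)) *_) shifted)) ⟩
    shift (fallingCoeff a) m + fallingCoeff a m + (- ι (suc a)) * fallingCoeff a m
  ≡⟨ cong (λ c → shift (fallingCoeff a) m + fallingCoeff a m + (- c) * fallingCoeff a m) (ι-suc a) ⟩
    shift (fallingCoeff a) m + fallingCoeff a m + (- (1ℚ + ι a)) * fallingCoeff a m
  ≡⟨ solve 3 (λ p x c → p :+ x :+ (:- (con 1ℚ :+ c)) :* x := p :- c :* x)
       refl (shift (fallingCoeff a) m) (fallingCoeff a m) (ι a) ⟩
    fallingCoeff (suc a) m
  ∎
  where
  s : Series
  s = fallingCoeff (suc a)
  shifted : Σ0 (suc a) (λ i → s (suc i) * ι (i C m)) ≡ fallingCoeff a m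
  shifted = trans (Σ0-dropLast a _ (trans (cong (_* ι (suc a C m)) (fallingCoeff-vanishes-above (suc a) (suc (suc a)) ℕP.≤-refl))
                                         (ℚP.*-zeroˡ (ι (suc a C m)))))
                  (Σ-fallingCoeff-binomial a m)
  unshifted : ∀ m → Σ0 (suc a) (λ i → s i * ι (i C m)) ≡ shift (fallingCoeff a) m + fallingCoeff a m
  unshifted m = begin
      Σ0 (suc a) (λ i → s i * ι (i C m))
    ≡⟨ Σ0-sucˡ a _ ⟩
      s 0 * ι (0 C m) + Σ0 a (λ i → s (suc i) * ι (suc i C m))
    ≡⟨ cong (_+ Σ0 a (λ i → s (suc i) * ι (suc i C m)))
            (trans (cong (_* ι (0 C m)) (fallingCoeff-suc-0 a)) (ℚP.*-zeroˡ (ι (0 C m)))) ⟩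
      0ℚ + Σ0 a (λ i → s (suc i) * ι (suc i C m))
    ≡⟨ ℚP.+-identityˡ _ ⟩
      Σ0 a (λ i → s (suc i) * ι (suc i C m))
    ≡⟨ Σ0-cong a (λ i → trans (cong (s (suc i) *_) (binomial-PascalStep i m))
                             (ℚP.*-distribˡ-+ (s (suc i)) _ _)) ⟩
      Σ0 a (λ i → s (suc i) * ι (i C m) + s (suc i) * shift (λ k → ι (i C k)) m)
    ≡⟨ Σ0-distrib-+ a _ _ ⟩
      Σ0 a (λ i → s (suc i) * ι (i C m)) + Σ0 a (λ i → s (suc i) * shift (λ k → ι (i C k)) m)
    ≡⟨ cong₂ _+_ (Σ-fallingCoeff-binomial a m)
                 (trans (Σ0-*-shift a (λ i → s (suc i)) (λ i k → ι (i C k)) m)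
                        (shift-cong (Σ-fallingCoeff-binomial a) m)) ⟩
      fallingCoeff a m + shift (fallingCoeff a) m
    ≡⟨ ℚP.+-comm (fallingCoeff a m) (shift (fallingCoeff a) m) ⟩
      shift (fallingCoeff a) m + fallingCoeff a m
    ∎

-- Σ_j S_r(n+1, j+1) s(j,m), with r = a + 1
rStirlingFalling : ℕ → ℕ → Series
rStirlingFalling a n m = Σ0 n (λ j → ι (rStirling2 (suc a) (suc n) (suc j)) * fallingCoeff j m)

-- Σ_{ℓ=1}^{r} s(r,ℓ) C(n-r+ℓ, m), with r = a + 1 and ℓ = i + 1
fallingBinomial : ℕ → ℕ → Series
fallingBinomial a n m = Σ0 a (λ i → fallingCoeff (suc a) (suc i) * ι ((n ℕ.+ suc i ∸ suc a) C m))

rStirlingFalling-diagonal : ∀ a m → rStirlingFalling a a m ≡ fallingCoeff a m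
rStirlingFalling-diagonal a m = begin
    rStirlingFalling a a m
  ≡⟨ Σ0-onlyLast a _ below ⟩
    ι (rStirling2 (suc a) (suc a) (suc a)) * fallingCoeff a m
  ≡⟨ cong (λ x → ι x * fallingCoeff a m)
       (trans (rStirling2-diagonal a (suc a)) (cong (λ b → if b then 1 else 0) (≡ᵇ-refl a))) ⟩
    ι 1 * fallingCoeff a m
  ≡⟨ ℚP.*-identityˡ (fallingCoeff a m) ⟩
    fallingCoeff a m
  ∎
  where
  below : ∀ i → i < a → ι (rStirling2 (suc a) (suc a) (suc i)) * fallingCoeff i m ≡ 0ℚ
  below i i<a rewrite rStirling2-diagonal a (suc i) | ≡ᵇ-false i a (λ i≡a → ℕP.<-irrefl i≡a i<a)
    = ℚP.*-zeroˡ (fallingCoeff i m)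

fallingBinomial-diagonal : ∀ a m → fallingBinomial a a m ≡ fallingCoeff a m
fallingBinomial-diagonal a m = trans
  (Σ0-cong a (λ i → cong (λ N → fallingCoeff (suc a) (suc i) * ι (N C m))
    (trans (cong (_∸ suc a) (ℕP.+-suc a i)) (ℕP.m+n∸m≡n a i))))
  (Σ-fallingCoeff-binomial a m)

fallingBinomial-PascalStep : ∀ a {n} → a ≤ n → PascalStep (fallingBinomial a) n
fallingBinomial-PascalStep a {n} a≤n m = begin
    Σ0 a (λ i → c i * ι ((suc n ℕ.+ suc i ∸ suc a) C m))
  ≡⟨ Σ0-cong a (λ i → cong (λ N → c i * ι (N C m)) (N-suc i)) ⟩
    Σ0 a (λ i → c i * ι (suc (N i) C m))
  ≡⟨ Σ0-cong a (λ i → trans (cong (c i *_) (binomial-PascalStep (N i) m)) (ℚP.*-distribˡ-+ (c i) _ _)) ⟩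
    Σ0 a (λ i → c i * ι (N i C m) + c i * shift (λ k → ι (N i C k)) m)
  ≡⟨ Σ0-distrib-+ a _ _ ⟩
    fallingBinomial a n m + Σ0 a (λ i → c i * shift (λ k → ι (N i C k)) m)
  ≡⟨ cong (fallingBinomial a n m +_) (Σ0-*-shift a c (λ i k → ι (N i C k)) m) ⟩
    fallingBinomial a n m + shift (fallingBinomial a n) m
  ∎
  where
  c : ℕ → ℚ
  c i = fallingCoeff (suc a) (suc i)
  N : ℕ → ℕ
  N i = n ℕ.+ suc i ∸ suc a
  N-suc : ∀ i → suc n ℕ.+ suc i ∸ suc a ≡ suc (N i)
  N-suc i = trans (cong (_∸ a) (ℕP.+-suc n i))
    (trans (ℕP.+-∸-assoc 1 (ℕP.≤-trans a≤n (ℕP.m≤m+n n i)))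
           (cong suc (sym (cong (_∸ suc a) (ℕP.+-suc n i)))))

-- Combines S_r(n+2, j+1) = (j+1) S_r(n+1, j+1) + S_r(n+1, j) with s(j+1, m) = s(j, m-1) - j s(j, m).
rStirlingFalling-PascalStep : ∀ a {n} → a ≤ n → PascalStep (rStirlingFalling a) n
rStirlingFalling-PascalStep a {n} a≤n m = begin
    Σ0 (suc n) (λ j → ι (rStirling2 (suc a) (suc (suc n)) (suc j)) * s j m)
  ≡⟨ Σ0-cong (suc n) recurrence ⟩
    Σ0 (suc n) (λ j → ι (suc j) * σ j * s j m + ι (σ′ j) * s j m)
  ≡⟨ Σ0-distrib-+ (suc n) _ _ ⟩
    Σ0 (suc n) (λ j → ι (suc j) * σ j * s j m) + Σ0 (suc n) (λ j → ι (σ′ j) * s j m)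
  ≡⟨ cong₂ _+_ (Σ0-dropLast n _ top-vanishes) (trans (Σ0-sucˡ n _) (trans
       (cong (_+ Σ0 n (λ j → σ j * s (suc j) m)) bottom-vanishes) (ℚP.+-identityˡ _))) ⟩
    Σ0 n (λ j → ι (suc j) * σ j * s j m) + Σ0 n (λ j → σ j * s (suc j) m)
  ≡⟨ sym (Σ0-distrib-+ n _ _) ⟩
    Σ0 n (λ j → ι (suc j) * σ j * s j m + σ j * s (suc j) m)
  ≡⟨ Σ0-cong n regroup ⟩
    Σ0 n (λ j → σ j * s j m + σ j * shift (s j) m)
  ≡⟨ Σ0-distrib-+ n _ _ ⟩
    rStirlingFalling a n m + Σ0 n (λ j → σ j * shift (s j) m)
  ≡⟨ cong (rStirlingFalling a n m +_) (Σ0-*-shift n σ s m) ⟩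
    rStirlingFalling a n m + shift (rStirlingFalling a n) m
  ∎
  where
  s : ℕ → Series
  s = fallingCoeff
  σ′ : ℕ → ℕ
  σ′ j = rStirling2 (suc a) (suc n) j
  σ : ℕ → ℚ
  σ j = ι (σ′ (suc j))
  recurrence : ∀ j → ι (rStirling2 (suc a) (suc (suc n)) (suc j)) * s j m
                   ≡ ι (suc j) * σ j * s j m + ι (σ′ j) * s j m
  recurrence j = begin
    ι (rStirling2 (suc a) (suc (suc n)) (suc j)) * s j m  ≡⟨ cong (λ x → ι x * s j m) (rStirling2-suc a n j a≤n) ⟩
    ι (suc j ℕ.* σ′ (suc j) ℕ.+ σ′ j) * s j m             ≡⟨ cong (_* s j m) (trans (ι-+ (suc j ℕ.* σ′ (suc j)) (σ′ j))
                                                                (cong (_+ ι (σ′ j)) (ι-* (suc j) (σ′ (suc j))))) ⟩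
    (ι (suc j) * σ j + ι (σ′ j)) * s j m                   ≡⟨ ℚP.*-distribʳ-+ (s j m) (ι (suc j) * σ j) (ι (σ′ j)) ⟩
    ι (suc j) * σ j * s j m + ι (σ′ j) * s j m             ∎
  top-vanishes : ι (suc (suc n)) * σ (suc n) * s (suc n) m ≡ 0ℚ
  top-vanishes rewrite rStirling2-vanishes-above a (suc n) (suc (suc n)) (ℕP.n<1+n (suc n))
    = trans (cong (_* s (suc n) m) (ℚP.*-zeroʳ (ι (suc (suc n))))) (ℚP.*-zeroˡ (s (suc n) m))
  bottom-vanishes : ι (σ′ 0) * s 0 m ≡ 0ℚ
  bottom-vanishes rewrite rStirling2-vanishes-below a (suc n) 0 (s≤s z≤n) = ℚP.*-zeroˡ (s 0 m)
  regroup : ∀ j → ι (suc j) * σ j * s j m + σ j * s (suc j) m ≡ σ j * s j m + σ j * shift (s j) m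
  regroup j rewrite ι-suc j =
    solve 4 (λ c t x y → (con 1ℚ :+ c) :* t :* x :+ t :* (y :- c :* x) := t :* x :+ t :* y)
      refl (ι j) (σ j) (s j m) (shift (s j) m)

rStirlingFalling≡fallingBinomial : ∀ a {n} → a ≤ n → ∀ m → rStirlingFalling a n m ≡ fallingBinomial a n m
rStirlingFalling≡fallingBinomial a = PascalStep-unique (rStirlingFalling a) (fallingBinomial a)
  (rStirlingFalling-PascalStep a) (fallingBinomial-PascalStep a)
  (λ m → trans (rStirlingFalling-diagonal a m) (sym (fallingBinomial-diagonal a m)))

Σ-*-polyCauchy : ∀ n (w : ℕ → ℚ) k →
  Σ0 n (λ j → w j * polyCauchy k j) ≡ Σ0 n (λ m → Σ0 n (λ j → w j * fallingCoeff j m) * invPow m k)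
Σ-*-polyCauchy n w k = begin
    Σ0 n (λ j → w j * polyCauchy k j)
  ≡⟨ Σ0-cong-≤ n expand ⟩
    Σ0 n (λ j → Σ0 n (λ m → w j * (fallingCoeff j m * invPow m k)))
  ≡⟨ Σ0-comm n n _ ⟩
    Σ0 n (λ m → Σ0 n (λ j → w j * (fallingCoeff j m * invPow m k)))
  ≡⟨ Σ0-cong n (λ m → trans (Σ0-cong n (λ j → sym (ℚP.*-assoc (w j) (fallingCoeff j m) (invPow m k))))
                            (sym (*-distribʳ-Σ0 n (invPow m k) _))) ⟩
    Σ0 n (λ m → Σ0 n (λ j → w j * fallingCoeff j m) * invPow m k)
  ∎
  where
  expand : ∀ j → j ≤ n → w j * polyCauchy k j ≡ Σ0 n (λ m → w j * (fallingCoeff j m * invPow m k))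
  expand j j≤n = begin
      w j * polyCauchy k j
    ≡⟨ cong (w j *_) (polyCauchy≡Σ-fallingCoeff k j) ⟩
      w j * Σ0 j (λ m → fallingCoeff j m * invPow m k)
    ≡⟨ cong (w j *_) (Σ0-extend _ j≤n (λ m j<m →
         trans (cong (_* invPow m k) (fallingCoeff-vanishes-above j m j<m)) (ℚP.*-zeroˡ (invPow m k)))) ⟩
      w j * Σ0 n (λ m → fallingCoeff j m * invPow m k)
    ≡⟨ *-distribˡ-Σ0 n (w j) _ ⟩
      Σ0 n (λ m → w j * (fallingCoeff j m * invPow m k))
    ∎

Σ-*-Σ-binomial : ∀ a n (c : ℕ → ℚ) (N : ℕ → ℕ) (g : ℕ → ℚ) → (∀ i → i ≤ a → N i ≤ n) →
  Σ0 n (λ m → Σ0 a (λ i → c i * ι (N i C m)) * g m)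
    ≡ Σ0 a (λ i → c i * Σ0 (N i) (λ b → ι (N i C b) * g b))
Σ-*-Σ-binomial a n c N g N≤n = begin
    Σ0 n (λ m → Σ0 a (λ i → c i * ι (N i C m)) * g m)
  ≡⟨ Σ0-cong n (λ m → trans (*-distribʳ-Σ0 a (g m) _)
                            (Σ0-cong a (λ i → ℚP.*-assoc (c i) (ι (N i C m)) (g m)))) ⟩
    Σ0 n (λ m → Σ0 a (λ i → c i * (ι (N i C m) * g m)))
  ≡⟨ Σ0-comm n a _ ⟩
    Σ0 a (λ i → Σ0 n (λ m → c i * (ι (N i C m) * g m)))
  ≡⟨ Σ0-cong-≤ a (λ i i≤a → trans (sym (*-distribˡ-Σ0 n (c i) _))
                                  (cong (c i *_) (sym (Σ0-extend _ (N≤n i i≤a) (binomial-tail i))))) ⟩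
    Σ0 a (λ i → c i * Σ0 (N i) (λ b → ι (N i C b) * g b))
  ∎
  where
  binomial-tail : ∀ i b → N i < b → ι (N i C b) * g b ≡ 0ℚ
  binomial-tail i b N<b = trans (cong (λ x → ι x * g b) (k>n⇒nCk≡0 N<b)) (ℚP.*-zeroˡ (g b))

theorem2 : (n r : ℕ) (k : ℤ) → 1 ≤ r → r ≤ n ℕ.+ 1 →
    Σ[ r ∸ 1 ⋯ n ] (λ j → ι (rStirling2 r (n ℕ.+ 1) (j ℕ.+ 1)) * polyCauchy k j)
      ≡ Σ[ 1 ⋯ r ] (λ ℓ → sgn (r ∸ ℓ) * ι (stirling1 r ℓ)
          * Σ[ 0 ⋯ n ℕ.+ ℓ ∸ r ] (λ i → ι ((n ℕ.+ ℓ ∸ r) C i) * invPow i k))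
theorem2 n (suc a) k _ r≤n+1 = begin
    Σ[ a ⋯ n ] (λ j → ι (rStirling2 (suc a) (n ℕ.+ 1) (j ℕ.+ 1)) * polyCauchy k j)
  ≡⟨ Σ-range≡Σ0-from-0 _ a≤n below-r ⟩
    Σ0 n (λ j → ι (rStirling2 (suc a) (n ℕ.+ 1) (j ℕ.+ 1)) * polyCauchy k j)
  ≡⟨ Σ0-cong n (λ j → cong₂ (λ N m → ι (rStirling2 (suc a) N m) * polyCauchy k j)
                            (ℕP.+-comm n 1) (ℕP.+-comm j 1)) ⟩
    Σ0 n (λ j → ι (rStirling2 (suc a) (suc n) (suc j)) * polyCauchy k j)
  ≡⟨ Σ-*-polyCauchy n (λ j → ι (rStirling2 (suc a) (suc n) (suc j))) k ⟩
    Σ0 n (λ m → rStirlingFalling a n m * invPow m k)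
  ≡⟨ Σ0-cong n (λ m → cong (_* invPow m k) (rStirlingFalling≡fallingBinomial a a≤n m)) ⟩
    Σ0 n (λ m → fallingBinomial a n m * invPow m k)
  ≡⟨ Σ-*-Σ-binomial a n (λ i → fallingCoeff (suc a) (suc i)) N (λ b → invPow b k) N≤n ⟩
    Σ0 a (λ i → fallingCoeff (suc a) (suc i) * binomialSum i)
  ≡⟨ Σ0-cong a (λ i → cong (_* binomialSum i) (fallingCoeff≡signed-stirling1 (suc a) (suc i))) ⟩
    Σ[ 1 ⋯ suc a ] (λ ℓ → sgn (suc a ∸ ℓ) * ι (stirling1 (suc a) ℓ)
      * Σ[ 0 ⋯ n ℕ.+ ℓ ∸ suc a ] (λ i → ι ((n ℕ.+ ℓ ∸ suc a) C i) * invPow i k))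
  ∎
  where
  a≤n : a ≤ n
  a≤n = ℕP.≤-pred (subst (suc a ≤_) (ℕP.+-comm n 1) r≤n+1)
  below-r : ∀ j → j < a → ι (rStirling2 (suc a) (n ℕ.+ 1) (j ℕ.+ 1)) * polyCauchy k j ≡ 0ℚ
  below-r j j<a rewrite ℕP.+-comm j 1 | rStirling2-vanishes-below a (n ℕ.+ 1) (suc j) (s≤s j<a)
    = ℚP.*-zeroˡ (polyCauchy k j)
  N : ℕ → ℕ
  N i = n ℕ.+ suc i ∸ suc a
  binomialSum : ℕ → ℚ
  binomialSum i = Σ0 (N i) (λ b → ι (N i C b) * invPow b k)
  N≤n : ∀ i → i ≤ a → N i ≤ n
  N≤n i i≤a = ℕP.≤-trans (ℕP.∸-monoˡ-≤ (suc a) (ℕP.+-monoʳ-≤ n (s≤s i≤a)))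
                        (ℕP.≤-reflexive (ℕP.m+n∸n≡m n (suc a)))
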